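{- For every positive integer $n$, the number $$a_n:=\frac{1}{8n^2\binom{2n}{n}^2}\sum_{k=0}^{n-1}(205k^2+160k+32)(-1)^{n-1-k}\binom{2k}{k}^5$$ is a positive integer. -}

module Defs where

open import Data.Nat using (ℕ; zero; suc)
open import Data.Nat.Combinatorics using (_C_)
open import Data.Integer using (ℤ; +_; _+_; _*_; -_)

sign : ℕ → ℤ
sign zero = + 1
sign (suc m) = - sign m

-- term k of the sum, for a given n:  (205k²+160k+32)(-1)^(n-1-k) C(2k,k)^5
-- Σ_{k=0}^{n-1} … ; we define S n directly by recursion on the upper limit,
-- with the exponent n-1-k computed as (n ∸ 1 ∸ k) on ℕ (k ≤ n-1 so it is exact).
open import Data.Nat using (_∸_; _^_) renaming (_+_ to _+ℕ_; _*_ to _*ℕ_)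

term : ℕ → ℕ → ℤ
term n k = + (205 *ℕ k *ℕ k +ℕ 160 *ℕ k +ℕ 32) * sign (n ∸ 1 ∸ k) * + (((2 *ℕ k) C k) ^ 5)

sumTo : ℕ → ℕ → ℤ
sumTo n zero = + 0
sumTo n (suc m) = sumTo n m + term n m

S : ℕ → ℤ
S n = sumTo n n

{-# OPTIONS --safe #-}
-- Write N = n + 1 and φ n k = C(n+k,k)² C(2n+1,k). The sum equals
-- (-1)ⁿ 8N² C(2N,N)² Σ_{k≤n} (-1)ᵏ φ n k, by induction on n: the alternating sums of φ
-- obey a first-order recurrence obtained by telescoping the WZ-type relation
-- K₁ φ(n+1,k) - K₂ φ(n,k) = Γ(n,k) + Γ(n,k-1). Every term of that relation is a rational
-- multiple of a single term, so after clearing denominators it is a polynomial identity.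
-- Finally φ n k increases strictly in k ≤ n, so (-1)ⁿ Σ_{k≤n} (-1)ᵏ φ n k is positive.
module Submission where

module Summands where
  open import Data.Nat
  open import Data.Nat.Properties
  open import Data.Nat.Combinatorics using (_C_; nC1≡n; nCk+nC[k+1]≡[n+1]C[k+1])
  open import Data.Nat.Tactic.RingSolver using (solve-∀)
  open import Algebra.Properties.CommutativeSemiring.Exp +-*-commutativeSemiring using (^-distrib-*)
  open import Algebra.Properties.CommutativeSemigroup *-commutativeSemigroup using (x∙yz≈y∙xz)
  open import Relation.Binary.PropositionalEquality
  open ≡-Reasoning

  [k+1]*[n+1]C[k+1]≡[n+1]*nCk : ∀ n k → suc k * (suc n C suc k) ≡ suc n * (n C k)
  [k+1]*[n+1]C[k+1]≡[n+1]*nCk zero    zero    = refl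
  [k+1]*[n+1]C[k+1]≡[n+1]*nCk zero    (suc k) = *-zeroʳ (2 + k)
  [k+1]*[n+1]C[k+1]≡[n+1]*nCk (suc n) zero    =
    trans (*-identityˡ _) (trans (nC1≡n (2 + n)) (sym (*-identityʳ (2 + n))))
  [k+1]*[n+1]C[k+1]≡[n+1]*nCk (suc n) (suc k) = begin
      suc (suc k) * (suc (suc n) C suc (suc k))
    ≡⟨ cong (suc (suc k) *_) (nCk+nC[k+1]≡[n+1]C[k+1] (suc n) (suc k)) ⟨
      suc (suc k) * (x + y)
    ≡⟨ *-distribˡ-+ (suc (suc k)) x y ⟩
      (x + suc k * x) + suc (suc k) * y
    ≡⟨ cong₂ (λ u v → (x + u) + v) ([k+1]*[n+1]C[k+1]≡[n+1]*nCk n k)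
                                    ([k+1]*[n+1]C[k+1]≡[n+1]*nCk n (suc k)) ⟩
      (x + suc n * (n C k)) + suc n * (n C suc k)
    ≡⟨ +-assoc x _ _ ⟩
      x + (suc n * (n C k) + suc n * (n C suc k))
    ≡⟨ cong (x +_) (*-distribˡ-+ (suc n) (n C k) (n C suc k)) ⟨
      x + suc n * (n C k + n C suc k)
    ≡⟨ cong (λ z → x + suc n * z) (nCk+nC[k+1]≡[n+1]C[k+1] n k) ⟩
      suc (suc n) * x
    ∎
    where
      x = suc n C suc k
      y = suc n C suc (suc k)

  [k+1]*nC[k+1]≡[n∸k]*nCk : ∀ n k → suc k * (n C suc k) ≡ (n ∸ k) * (n C k)
  [k+1]*nC[k+1]≡[n∸k]*nCk n k = begin
      suc k * y                         ≡⟨ m+n∸m≡n (suc k * x) (suc k * y) ⟨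
      suc k * x + suc k * y ∸ suc k * x ≡⟨ cong (_∸ suc k * x) pascal ⟩
      suc n * x ∸ suc k * x             ≡⟨ *-distribʳ-∸ x (suc n) (suc k) ⟨
      (n ∸ k) * x                       ∎
    where
      x = n C k
      y = n C suc k
      pascal : suc k * x + suc k * y ≡ suc n * x
      pascal = begin
        suc k * x + suc k * y   ≡⟨ *-distribˡ-+ (suc k) x y ⟨
        suc k * (x + y)         ≡⟨ cong (suc k *_) (nCk+nC[k+1]≡[n+1]C[k+1] n k) ⟩
        suc k * (suc n C suc k) ≡⟨ [k+1]*[n+1]C[k+1]≡[n+1]*nCk n k ⟩
        suc n * x               ∎

  [n+1∸k]*[n+1]Ck≡[n+1]*nCk : ∀ n k → (suc n ∸ k) * (suc n C k) ≡ suc n * (n C k)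
  [n+1∸k]*[n+1]Ck≡[n+1]*nCk n k =
    trans (sym ([k+1]*nC[k+1]≡[n∸k]*nCk (suc n) k)) ([k+1]*[n+1]C[k+1]≡[n+1]*nCk n k)

  nCk>0 : ∀ {n k} → k ≤ n → n C k > 0
  nCk>0 {n}     {zero}  _         = z<s
  nCk>0 {suc n} {suc k} (s≤s k≤n) = <-≤-trans (nCk>0 k≤n)
    (subst (n C k ≤_) (nCk+nC[k+1]≡[n+1]C[k+1] n k) (m≤m+n (n C k) (n C suc k)))

  T : ℕ → ℕ → ℕ → ℕ
  T n m k = ((k + n) C k) ^ 2 * (m C k)

  T>0 : ∀ n {m k} → k ≤ m → T n m k > 0
  T>0 n {m} {k} k≤m =
    *-mono-< (m^n>0 ((k + n) C k) {{>-nonZero (nCk>0 (m≤m+n k n))}} 2) (nCk>0 k≤m)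

  *-scale-square : ∀ {a b x y} u → a * x ≡ b * y → a ^ 2 * (x ^ 2 * u) ≡ b ^ 2 * (y ^ 2 * u)
  *-scale-square {a} {b} {x} {y} u ax≡by = begin
    a ^ 2 * (x ^ 2 * u) ≡⟨ *-assoc (a ^ 2) (x ^ 2) u ⟨
    a ^ 2 * x ^ 2 * u   ≡⟨ cong (_* u) (^-distrib-* a x 2) ⟨
    (a * x) ^ 2 * u     ≡⟨ cong (λ z → z ^ 2 * u) ax≡by ⟩
    (b * y) ^ 2 * u     ≡⟨ cong (_* u) (^-distrib-* b y 2) ⟩
    b ^ 2 * y ^ 2 * u   ≡⟨ *-assoc (b ^ 2) (y ^ 2) u ⟩
    b ^ 2 * (y ^ 2 * u) ∎

  T-suc-n : ∀ n m k → suc n ^ 2 * T (suc n) m k ≡ (k + suc n) ^ 2 * T n m k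
  T-suc-n n m k = *-scale-square {suc n} {k + suc n} {(k + suc n) C k} {(k + n) C k} (m C k) (begin
      suc n * ((k + suc n) C k)
    ≡⟨ cong (_* ((k + suc n) C k)) (m+n∸m≡n k (suc n)) ⟨
      (k + suc n ∸ k) * ((k + suc n) C k)
    ≡⟨ cong (λ j → (j ∸ k) * (j C k)) (+-suc k n) ⟩
      (suc (k + n) ∸ k) * (suc (k + n) C k)
    ≡⟨ [n+1∸k]*[n+1]Ck≡[n+1]*nCk (k + n) k ⟩
      suc (k + n) * ((k + n) C k)
    ≡⟨ cong (_* ((k + n) C k)) (+-suc k n) ⟨
      (k + suc n) * ((k + n) C k)
    ∎)

  T-suc-k : ∀ n m k → suc k ^ 3 * T n m (suc k) ≡ (suc k + n) ^ 2 * (m ∸ k) * T n m k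
  T-suc-k n m k = begin
      a * a ^ 2 * (x ^ 2 * u)
    ≡⟨ shuffle a (a ^ 2) (x ^ 2) u ⟩
      a ^ 2 * (x ^ 2 * (a * u))
    ≡⟨ *-scale-square {a} {suc k + n} {x} {y} (a * u) ([k+1]*[n+1]C[k+1]≡[n+1]*nCk (k + n) k) ⟩
      (suc k + n) ^ 2 * (y ^ 2 * (a * u))
    ≡⟨ cong (λ z → (suc k + n) ^ 2 * (y ^ 2 * z)) ([k+1]*nC[k+1]≡[n∸k]*nCk m k) ⟩
      (suc k + n) ^ 2 * (y ^ 2 * ((m ∸ k) * (m C k)))
    ≡⟨ shuffle (m ∸ k) ((suc k + n) ^ 2) (y ^ 2) (m C k) ⟨
      (m ∸ k) * (suc k + n) ^ 2 * (y ^ 2 * (m C k))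
    ≡⟨ cong (_* T n m k) (*-comm (m ∸ k) ((suc k + n) ^ 2)) ⟩
      (suc k + n) ^ 2 * (m ∸ k) * T n m k
    ∎
    where
      a = suc k
      x = (suc k + n) C suc k
      y = (k + n) C k
      u = m C suc k
      shuffle : ∀ p q r s → p * q * (r * s) ≡ q * (r * (p * s))
      shuffle = solve-∀

  T-suc-m : ∀ n m k → (suc m ∸ k) * T n (suc m) k ≡ suc m * T n m k
  T-suc-m n m k = begin
    (suc m ∸ k) * (x * (suc m C k))   ≡⟨ x∙yz≈y∙xz (suc m ∸ k) x (suc m C k) ⟩
    x * ((suc m ∸ k) * (suc m C k))   ≡⟨ cong (x *_) ([n+1∸k]*[n+1]Ck≡[n+1]*nCk m k) ⟩
    x * (suc m * (m C k))             ≡⟨ x∙yz≈y∙xz x (suc m) (m C k) ⟩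
    suc m * (x * (m C k))             ∎
    where
      x = ((k + n) C k) ^ 2

  φ ψ : ℕ → ℕ → ℕ
  φ n = T n (suc (n + n))
  ψ n = T n (suc (suc n + suc n))

  φ-increasing : ∀ {n k} → k < n → φ n k < φ n (suc k)
  φ-increasing {n} {k} k<n = *-cancelˡ-< (suc k ^ 3) (φ n k) (φ n (suc k))
    (subst₂ _<_ (cong (_* φ n k) (*-comm (suc k ^ 2) (suc k))) (sym (T-suc-k n (suc (n + n)) k))
      (*-monoˡ-< (φ n k) {{>-nonZero (T>0 n k≤2n+1)}} (*-mono-< square< factor<)))
    where
      k≤2n+1 : k ≤ suc (n + n)
      k≤2n+1 = ≤-trans (<⇒≤ k<n) (≤-trans (m≤m+n n n) (n≤1+n (n + n)))
      square< : suc k ^ 2 < (suc k + n) ^ 2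
      square< = ^-monoˡ-< 2 (m<m+n (suc k) (≤-trans (s≤s z≤n) k<n))
      factor< : suc k < suc (n + n) ∸ k
      factor< = m+n≤o⇒m≤o∸n (suc (suc k)) (s≤s (+-mono-≤ k<n (<⇒≤ k<n)))

  central-binomial-suc : ∀ m → suc m * ((suc m + suc m) C suc m) ≡ 2 * suc (m + m) * ((m + m) C m)
  central-binomial-suc m = *-cancelˡ-≡ _ _ (suc m) (begin
      suc m * (suc m * ((suc m + suc m) C suc m))
    ≡⟨ cong (suc m *_) ([k+1]*[n+1]C[k+1]≡[n+1]*nCk (m + suc m) m) ⟩
      suc m * (suc (m + suc m) * ((m + suc m) C m))
    ≡⟨ cong (λ j → suc m * (suc j * (j C m))) (+-suc m m) ⟩
      suc m * (suc (suc (m + m)) * (suc (m + m) C m))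
    ≡⟨ x∙yz≈y∙xz (suc m) (suc (suc (m + m))) (suc (m + m) C m) ⟩
      suc (suc (m + m)) * (suc m * (suc (m + m) C m))
    ≡⟨ cong (λ d → suc (suc (m + m)) * (d * (suc (m + m) C m))) (m+n∸n≡m (suc m) m) ⟨
      suc (suc (m + m)) * ((suc (m + m) ∸ m) * (suc (m + m) C m))
    ≡⟨ cong (suc (suc (m + m)) *_) ([n+1∸k]*[n+1]Ck≡[n+1]*nCk (m + m) m) ⟩
      suc (suc (m + m)) * (suc (m + m) * ((m + m) C m))
    ≡⟨ regroup m ((m + m) C m) ⟩
      suc m * (2 * suc (m + m) * ((m + m) C m))
    ∎)
    where
      regroup : ∀ m z → suc (suc (m + m)) * (suc (m + m) * z) ≡ suc m * (2 * suc (m + m) * z)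
      regroup = solve-∀

module Sums where
  open import Agda.Builtin.FromNat using (Number; fromNat)
  open import Data.Unit using (tt)
  open import Data.List using (_∷_; [])
  open import Data.Nat as ℕ using (ℕ; zero; suc)
  import Data.Nat.Properties as ℕ
  open import Data.Nat.Combinatorics using (_C_)
  open import Data.Integer hiding (suc; _^_; sign)
  open import Data.Integer.Properties
    using (pos-*; *-cancelˡ-≡; ⊖-≥; m-n≡m⊖n; *-identityˡ; *-identityʳ; *-comm;
           neg-distribˡ-*; neg-distribʳ-*; neg-involutive; neg-distrib-+)
  import Data.Integer.Literals as ℤ
  import Data.Nat.Literals as ℕ
  open import Data.Integer.Tactic.RingSolver using (ring; solve-∀; solve)
  open import Tactic.RingSolver.Core.AlmostCommutativeRing using (AlmostCommutativeRing)
  open AlmostCommutativeRing ring using (_^_)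
  open import Data.Product using (∃; _×_; _,_; proj₁; proj₂)
  open import Relation.Binary.PropositionalEquality
  open ≡-Reasoning
  open import Defs using (sign; term; sumTo; S)
  open Summands

  instance
    ℤ-number : Number ℤ
    ℤ-number = ℤ.number
    ℕ-number : Number ℕ
    ℕ-number = ℕ.number

  ^-suc : ∀ x k → x ^ suc k ≡ x * x ^ k
  ^-suc x zero    = sym (*-identityʳ x)
  ^-suc x (suc k) = *-comm (x ^ suc k) x

  pos-^ : ∀ a k → + (a ℕ.^ k) ≡ (+ a) ^ k
  pos-^ a zero    = refl
  pos-^ a (suc k) = begin
    + (a ℕ.* a ℕ.^ k) ≡⟨ pos-* a (a ℕ.^ k) ⟩
    + a * + (a ℕ.^ k) ≡⟨ cong (+ a *_) (pos-^ a k) ⟩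
    + a * (+ a) ^ k   ≡⟨ ^-suc (+ a) k ⟨
    (+ a) ^ suc k     ∎

  pos-^-* : ∀ a i b → + (a ℕ.^ i ℕ.* b) ≡ (+ a) ^ i * + b
  pos-^-* a i b = trans (pos-* (a ℕ.^ i) b) (cong (_* + b) (pos-^ a i))

  pos-∸ : ∀ {m k} → k ℕ.≤ m → + (m ℕ.∸ k) ≡ + m - + k
  pos-∸ {m} {k} k≤m = trans (sym (⊖-≥ k≤m)) (sym (m-n≡m⊖n m k))

  [n+1-k]*[n+1]Ck≡[n+1]*nCk : ∀ n {k} → k ℕ.≤ suc n →
    (1 + + n - + k) * + (suc n C k) ≡ (1 + + n) * + (n C k)
  [n+1-k]*[n+1]Ck≡[n+1]*nCk n {k} k≤n+1 = begin
    (1 + + n - + k) * + (suc n C k)     ≡⟨ cong (_* + (suc n C k)) (pos-∸ k≤n+1) ⟨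
    + (suc n ℕ.∸ k) * + (suc n C k)     ≡⟨ pos-* (suc n ℕ.∸ k) (suc n C k) ⟨
    + ((suc n ℕ.∸ k) ℕ.* (suc n C k))   ≡⟨ cong +_ ([n+1∸k]*[n+1]Ck≡[n+1]*nCk n k) ⟩
    + (suc n ℕ.* (n C k))               ≡⟨ pos-* (suc n) (n C k) ⟩
    (1 + + n) * + (n C k)               ∎

  T-suc-k′ : ∀ n {m} k → k ℕ.≤ m →
    (1 + + k) ^ 3 * + T n m (suc k) ≡ (1 + + k + + n) ^ 2 * (+ m - + k) * + T n m k
  T-suc-k′ n {m} k k≤m = begin
      (1 + + k) ^ 3 * + T n m (suc k)
    ≡⟨ pos-^-* (suc k) 3 (T n m (suc k)) ⟨
      + (suc k ℕ.^ 3 ℕ.* T n m (suc k))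
    ≡⟨ cong +_ (T-suc-k n m k) ⟩
      + ((suc k ℕ.+ n) ℕ.^ 2 ℕ.* (m ℕ.∸ k) ℕ.* T n m k)
    ≡⟨ pos-* ((suc k ℕ.+ n) ℕ.^ 2 ℕ.* (m ℕ.∸ k)) (T n m k) ⟩
      + ((suc k ℕ.+ n) ℕ.^ 2 ℕ.* (m ℕ.∸ k)) * + T n m k
    ≡⟨ cong (_* + T n m k) (pos-^-* (suc k ℕ.+ n) 2 (m ℕ.∸ k)) ⟩
      (1 + + k + + n) ^ 2 * + (m ℕ.∸ k) * + T n m k
    ≡⟨ cong (λ d → (1 + + k + + n) ^ 2 * d * + T n m k) (pos-∸ k≤m) ⟩
      (1 + + k + + n) ^ 2 * (+ m - + k) * + T n m k
    ∎

  T-suc-n′ : ∀ n m k → (1 + + n) ^ 2 * + T (suc n) m k ≡ (+ k + (1 + + n)) ^ 2 * + T n m k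
  T-suc-n′ n m k = begin
    (1 + + n) ^ 2 * + T (suc n) m k        ≡⟨ pos-^-* (suc n) 2 (T (suc n) m k) ⟨
    + (suc n ℕ.^ 2 ℕ.* T (suc n) m k)      ≡⟨ cong +_ (T-suc-n n m k) ⟩
    + ((k ℕ.+ suc n) ℕ.^ 2 ℕ.* T n m k)    ≡⟨ pos-^-* (k ℕ.+ suc n) 2 (T n m k) ⟩
    (+ k + (1 + + n)) ^ 2 * + T n m k      ∎

  T-suc-m′ : ∀ n {m} k → k ℕ.≤ suc m → (1 + + m - + k) * + T n (suc m) k ≡ (1 + + m) * + T n m k
  T-suc-m′ n {m} k k≤m+1 = begin
    (1 + + m - + k) * + T n (suc m) k       ≡⟨ cong (_* + T n (suc m) k) (pos-∸ k≤m+1) ⟨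
    + (suc m ℕ.∸ k) * + T n (suc m) k       ≡⟨ pos-* (suc m ℕ.∸ k) (T n (suc m) k) ⟨
    + ((suc m ℕ.∸ k) ℕ.* T n (suc m) k)     ≡⟨ cong +_ (T-suc-m n m k) ⟩
    + (suc m ℕ.* T n m k)                   ≡⟨ pos-* (suc m) (T n m k) ⟩
    (1 + + m) * + T n m k                   ∎

  altSum : (ℕ → ℤ) → ℕ → ℤ
  altSum f zero    = f zero
  altSum f (suc m) = altSum f m + sign (suc m) * f (suc m)

  sign-square : ∀ m → sign m * sign m ≡ 1
  sign-square zero    = refl
  sign-square (suc m) = begin
    - s * - s     ≡⟨ neg-distribˡ-* s (- s) ⟨
    - (s * - s)   ≡⟨ cong -_ (neg-distribʳ-* s s) ⟨
    - - (s * s)   ≡⟨ neg-involutive (s * s) ⟩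
    s * s         ≡⟨ sign-square m ⟩
    1             ∎
    where s = sign m

  altSum-linear : ∀ (a b : ℤ) (f g : ℕ → ℤ) m →
    altSum (λ k → a * f k - b * g k) m ≡ a * altSum f m - b * altSum g m
  altSum-linear a b f g zero    = refl
  altSum-linear a b f g (suc m) =
    trans (cong (_+ sign (suc m) * (a * f (suc m) - b * g (suc m))) (altSum-linear a b f g m))
          (regroup a b (altSum f m) (altSum g m) (sign (suc m)) (f (suc m)) (g (suc m)))
    where
      regroup : ∀ a b F G s x y → a * F - b * G + s * (a * x - b * y) ≡ a * (F + s * x) - b * (G + s * y)
      regroup = solve-∀

  telescope : ∀ (f G : ℕ → ℤ) m → f 0 ≡ G 0 →
    (∀ {k} → k ℕ.< m → f (suc k) ≡ G (suc k) + G k) → altSum f m ≡ sign m * G m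
  telescope f G zero    f0≡G0 _    = trans f0≡G0 (sym (*-identityˡ (G 0)))
  telescope f G (suc m) f0≡G0 step = begin
      altSum f m + - sign m * f (suc m)
    ≡⟨ cong₂ (λ u v → u + - sign m * v)
             (telescope f G m f0≡G0 (λ k<m → step (ℕ.m<n⇒m<1+n k<m))) (step ℕ.≤-refl) ⟩
      sign m * G m + - sign m * (G (suc m) + G m)
    ≡⟨ cancel (sign m) (G (suc m)) (G m) ⟩
      - sign m * G (suc m)
    ∎
    where
      cancel : ∀ s x y → s * y + - s * (x + y) ≡ - s * x
      cancel = solve-∀

  altSum-increasing : ∀ (f : ℕ → ℕ) m → 0 ℕ.< f 0 → (∀ {k} → k ℕ.< m → f k ℕ.< f (suc k)) →
    ∃ λ a → sign m * altSum (λ k → + f k) m ≡ + suc a × suc a ℕ.≤ f m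
  altSum-increasing f zero f0>0 _ =
    ℕ.pred (f 0) , trans (*-identityˡ (+ f 0)) (cong +_ (sym f0≡1+a)) , ℕ.≤-reflexive f0≡1+a
    where
      f0≡1+a : suc (ℕ.pred (f 0)) ≡ f 0
      f0≡1+a = ℕ.suc-pred (f 0) {{ℕ.>-nonZero f0>0}}
  altSum-increasing f (suc m) f0>0 increasing
    with altSum-increasing f m f0>0 (λ k<m → increasing (ℕ.m<n⇒m<1+n k<m))
  ... | a , sA≡1+a , 1+a≤fm
    with ℕ.m≤n⇒∃[o]m+o≡n (ℕ.≤-<-trans 1+a≤fm (increasing ℕ.≤-refl))
  ... | b , 2+a+b≡f = b , value , subst (suc b ℕ.≤_) 2+a+b≡f (ℕ.s≤s (ℕ.m≤n+m b (suc a)))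
    where
      s = sign m
      A = altSum (λ k → + f k) m
      expand : ∀ s A x → - s * (A + - s * x) ≡ s * s * x - s * A
      expand = solve-∀
      difference : ∀ a b → 1 * (2 + a + b) - (1 + a) ≡ 1 + b
      difference = solve-∀
      value : - s * (A + - s * + f (suc m)) ≡ + suc b
      value = begin
        - s * (A + - s * + f (suc m))      ≡⟨ expand s A (+ f (suc m)) ⟩
        s * s * + f (suc m) - s * A        ≡⟨ cong₂ (λ u v → u * + f (suc m) - v) (sign-square m) sA≡1+a ⟩
        1 * + f (suc m) - + suc a          ≡⟨ cong (λ z → 1 * + z - + suc a) 2+a+b≡f ⟨
        1 * + (2 ℕ.+ a ℕ.+ b) - + suc a    ≡⟨ difference (+ a) (+ b) ⟩
        + suc b                            ∎

  U : ℕ → ℕ → ℤ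
  U n = altSum (λ k → + φ n k)

  K₁ K₂ P : ℤ → ℤ
  K₁ N = 8 * N ^ 2 * (2 * N + 1) ^ 3
  K₂ N = 2 * N ^ 4 * (2 * N + 1)
  P N = 205 * N * N + 160 * N + 32

  q : ℤ → ℤ → ℤ
  q N k = 16 * k - 40 * k ^ 2 + 32 * k ^ 3 - 8 * k ^ 4
        + N * (22 - 29 * k - 45 * k ^ 2 + 73 * k ^ 3 - 21 * k ^ 4)
        + N ^ 2 * (38 - 186 * k + 186 * k ^ 2 - 30 * k ^ 3)
        + N ^ 3 * (- 82 + 67 * k + 63 * k ^ 2)
        + N ^ 4 * (- 38 + 132 * k)
        + 60 * N ^ 5

  Γ : ℕ → ℕ → ℤ
  Γ n k = q (+ suc n) (+ suc k) * + ψ n k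

  -- K₁, K₂, P and q are unfolded by hand: the ring solver treats defined names as opaque.
  certificates : ∀ (X J : ℤ) →
    let N = 1 + X
        K = 1 + J
        A = 1 + (N + N)
        B = 1 + (X + N)
        R = (K + X) ^ 2 * (1 + N + N - J)
        k₁ = 8 * N ^ 2 * (2 * N + 1) ^ 3
        k₂ = 2 * N ^ 4 * (2 * N + 1)
        p = 205 * N * N + 160 * N + 32
        q k = 16 * k - 40 * k ^ 2 + 32 * k ^ 3 - 8 * k ^ 4
            + N * (22 - 29 * k - 45 * k ^ 2 + 73 * k ^ 3 - 21 * k ^ 4)
            + N ^ 2 * (38 - 186 * k + 186 * k ^ 2 - 30 * k ^ 3)
            + N ^ 3 * (- 82 + 67 * k + 63 * k ^ 2)
            + N ^ 4 * (- 38 + 132 * k)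
            + 60 * N ^ 5
    in (k₁ * 1 - k₂ * 1 ≡ q 1 * 1)
     × (8 * A ^ 3 * B * (K + N) ^ 2 * R - 2 * N ^ 4 * (B - K) * (A - K) * R
         ≡ q (1 + K) * B * R + q K * B * K ^ 3)
     × (4 * A * (k₁ * (N + N) ^ 2 * (A - X) * (X + N) ^ 2 - q N * N ^ 5)
         ≡ N ^ 2 * A * p * (A - N) * (N + N) ^ 2 * (A - X) * (X + N) ^ 2)
  certificates X J = solve (X ∷ J ∷ []) , solve (X ∷ J ∷ []) , solve (X ∷ J ∷ [])

  -- N, K, A, B stand for n+1, j+1, 2n+3, 2n+2, and every term is a rational multiple of
  -- ψ₀ = ψ n j. Keeping N, K, A, B independent (only 2N+1 = A is used) keeps the solver's
  -- polynomials small.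
  wz-cleared : ∀ (N K A B r q₁ q₂ φ₁ φ₀ χ ψ₁ ψ₀ : ℤ) →
    2 * N + 1 ≡ A →
    K ^ 3 * ψ₁ ≡ r * ψ₀ →
    N ^ 2 * φ₁ ≡ (K + N) ^ 2 * ψ₁ →
    (A - K) * ψ₁ ≡ A * χ →
    (B - K) * χ ≡ B * φ₀ →
    8 * A ^ 3 * B * (K + N) ^ 2 * r - 2 * N ^ 4 * (B - K) * (A - K) * r ≡ q₂ * B * r + q₁ * B * K ^ 3 →
    N ^ 2 * A * B * K ^ 3 * (K₁ N * φ₁ - K₂ N * φ₀) ≡ N ^ 2 * A * B * K ^ 3 * (q₂ * ψ₁ + q₁ * ψ₀)
  wz-cleared N K A B r q₁ q₂ φ₁ φ₀ χ ψ₁ ψ₀ 2N+1≡A hψ hφ₁ hχ hφ₀ certificate = begin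
      N ^ 2 * A * B * K ^ 3 * (8 * N ^ 2 * (2 * N + 1) ^ 3 * φ₁ - 2 * N ^ 4 * (2 * N + 1) * φ₀)
    ≡⟨ cong (λ a → N ^ 2 * A * B * K ^ 3 * (8 * N ^ 2 * a ^ 3 * φ₁ - 2 * N ^ 4 * a * φ₀)) 2N+1≡A ⟩
      N ^ 2 * A * B * K ^ 3 * (8 * N ^ 2 * A ^ 3 * φ₁ - 2 * N ^ 4 * A * φ₀)
    ≡⟨ solve (N ∷ K ∷ A ∷ B ∷ φ₁ ∷ φ₀ ∷ []) ⟩
      N ^ 2 * A * (8 * A ^ 3 * B * (K ^ 3 * (N ^ 2 * φ₁)) - 2 * N ^ 4 * (B * (K ^ 3 * (A * φ₀))))
    ≡⟨ cong₂ (λ u v → N ^ 2 * A * (8 * A ^ 3 * B * u - 2 * N ^ 4 * v)) φ₁-via-ψ₀ φ₀-via-ψ₀ ⟩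
      N ^ 2 * A * (8 * A ^ 3 * B * ((K + N) ^ 2 * r * ψ₀) - 2 * N ^ 4 * ((B - K) * (A - K) * r * ψ₀))
    ≡⟨ solve (N ∷ K ∷ A ∷ B ∷ r ∷ ψ₀ ∷ []) ⟩
      N ^ 2 * A * ((8 * A ^ 3 * B * (K + N) ^ 2 * r - 2 * N ^ 4 * (B - K) * (A - K) * r) * ψ₀)
    ≡⟨ cong (λ u → N ^ 2 * A * (u * ψ₀)) certificate ⟩
      N ^ 2 * A * ((q₂ * B * r + q₁ * B * K ^ 3) * ψ₀)
    ≡⟨ solve (N ∷ K ∷ A ∷ B ∷ r ∷ q₁ ∷ q₂ ∷ ψ₀ ∷ []) ⟩
      N ^ 2 * A * B * (q₂ * (r * ψ₀)) + N ^ 2 * A * B * K ^ 3 * (q₁ * ψ₀)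
    ≡⟨ cong (λ u → N ^ 2 * A * B * (q₂ * u) + N ^ 2 * A * B * K ^ 3 * (q₁ * ψ₀)) hψ ⟨
      N ^ 2 * A * B * (q₂ * (K ^ 3 * ψ₁)) + N ^ 2 * A * B * K ^ 3 * (q₁ * ψ₀)
    ≡⟨ solve (N ∷ K ∷ A ∷ B ∷ q₁ ∷ q₂ ∷ ψ₁ ∷ ψ₀ ∷ []) ⟩
      N ^ 2 * A * B * K ^ 3 * (q₂ * ψ₁ + q₁ * ψ₀)
    ∎
    where
      φ₁-via-ψ₀ : K ^ 3 * (N ^ 2 * φ₁) ≡ (K + N) ^ 2 * r * ψ₀
      φ₁-via-ψ₀ = begin
        K ^ 3 * (N ^ 2 * φ₁)        ≡⟨ cong (K ^ 3 *_) hφ₁ ⟩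
        K ^ 3 * ((K + N) ^ 2 * ψ₁)  ≡⟨ solve (K ∷ N ∷ ψ₁ ∷ []) ⟩
        (K + N) ^ 2 * (K ^ 3 * ψ₁)  ≡⟨ cong ((K + N) ^ 2 *_) hψ ⟩
        (K + N) ^ 2 * (r * ψ₀)      ≡⟨ solve (K ∷ N ∷ r ∷ ψ₀ ∷ []) ⟩
        (K + N) ^ 2 * r * ψ₀        ∎
      φ₀-via-ψ₀ : B * (K ^ 3 * (A * φ₀)) ≡ (B - K) * (A - K) * r * ψ₀
      φ₀-via-ψ₀ = begin
        B * (K ^ 3 * (A * φ₀))             ≡⟨ solve (B ∷ K ∷ A ∷ φ₀ ∷ []) ⟩
        K ^ 3 * (A * (B * φ₀))             ≡⟨ cong (λ u → K ^ 3 * (A * u)) hφ₀ ⟨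
        K ^ 3 * (A * ((B - K) * χ))        ≡⟨ solve (K ∷ A ∷ B ∷ χ ∷ []) ⟩
        K ^ 3 * ((B - K) * (A * χ))        ≡⟨ cong (λ u → K ^ 3 * ((B - K) * u)) hχ ⟨
        K ^ 3 * ((B - K) * ((A - K) * ψ₁)) ≡⟨ solve (K ∷ A ∷ B ∷ ψ₁ ∷ []) ⟩
        (B - K) * (A - K) * (K ^ 3 * ψ₁)   ≡⟨ cong ((B - K) * (A - K) *_) hψ ⟩
        (B - K) * (A - K) * (r * ψ₀)       ≡⟨ solve (K ∷ A ∷ B ∷ r ∷ ψ₀ ∷ []) ⟩
        (B - K) * (A - K) * r * ψ₀         ∎

  2x+1≡1+[x+x] : ∀ x → 2 * x + 1 ≡ 1 + (x + x)
  2x+1≡1+[x+x] = solve-∀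

  wz-zero : ∀ n → K₁ (+ suc n) * + φ (suc n) 0 - K₂ (+ suc n) * + φ n 0 ≡ Γ n 0
  wz-zero n = proj₁ (certificates (+ n) 0)

  wz-suc : ∀ n {j} → j ℕ.< n →
    K₁ (+ suc n) * + φ (suc n) (suc j) - K₂ (+ suc n) * + φ n (suc j) ≡ Γ n (suc j) + Γ n j
  wz-suc n {j} j<n = *-cancelˡ-≡ (N ^ 2 * A * B * K ^ 3) _ _
    (wz-cleared N K A B ((K + + n) ^ 2 * (+ M - + j)) (q N K) (q N (1 + K))
      (+ φ (suc n) (suc j)) (+ φ n (suc j)) (+ T n (suc n ℕ.+ suc n) (suc j)) (+ ψ n (suc j)) (+ ψ n j)
      (2x+1≡1+[x+x] N)
      (T-suc-k′ n j j≤2n+3)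
      (T-suc-n′ n M (suc j))
      (T-suc-m′ n {suc n ℕ.+ suc n} (suc j) j+1≤2n+3)
      (trans (T-suc-m′ n {n ℕ.+ suc n} (suc j) j+1≤2n+2)
             (cong (λ m → B * + T n m (suc j)) (ℕ.+-suc n n)))
      (proj₁ (proj₂ (certificates (+ n) (+ j)))))
    where
      N = + suc n
      K = + suc j
      A = 1 + (N + N)
      B = 1 + (+ n + N)
      M = suc (suc n ℕ.+ suc n)
      j+1≤2n+2 : suc j ℕ.≤ suc (n ℕ.+ suc n)
      j+1≤2n+2 = ℕ.≤-trans j<n (ℕ.≤-trans (ℕ.m≤m+n n (suc n)) (ℕ.n≤1+n _))
      j+1≤2n+3 : suc j ℕ.≤ suc (suc n ℕ.+ suc n)
      j+1≤2n+3 = ℕ.m≤n⇒m≤1+n j+1≤2n+2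
      j≤2n+3 : j ℕ.≤ suc (suc n ℕ.+ suc n)
      j≤2n+3 = ℕ.≤-trans (ℕ.n≤1+n j) j+1≤2n+3

  wz-telescoped : ∀ n → K₁ (+ suc n) * U (suc n) n - K₂ (+ suc n) * U n n ≡ sign n * Γ n n
  wz-telescoped n =
    trans (sym (altSum-linear (K₁ (+ suc n)) (K₂ (+ suc n)) (λ k → + φ (suc n) k) (λ k → + φ n k) n))
          (telescope _ (Γ n) n (wz-zero n) (wz-suc n))

  -- X, N, A stand for n, n+1, 2n+3, and every term is a rational multiple of ψ = ψ n n.
  wz-boundary-cleared : ∀ (X N A k₁ q₀ p φ₁₁ φ₁₀ ψ c C′ : ℤ) →
    N ^ 3 * φ₁₁ ≡ (N + N) ^ 2 * (A - X) * φ₁₀ →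
    N ^ 2 * φ₁₀ ≡ (X + N) ^ 2 * ψ →
    (A - N) * C′ ≡ A * c →
    φ₁₁ ≡ c ^ 2 * C′ →
    4 * A * (k₁ * (N + N) ^ 2 * (A - X) * (X + N) ^ 2 - q₀ * N ^ 5)
      ≡ N ^ 2 * A * p * (A - N) * (N + N) ^ 2 * (A - X) * (X + N) ^ 2 →
    N ^ 5 * A * (4 * (k₁ * φ₁₁ - q₀ * ψ)) ≡ N ^ 5 * A * (N ^ 2 * A * (p * c ^ 3))
  wz-boundary-cleared X N A k₁ q₀ p φ₁₁ φ₁₀ ψ c C′ h₁₁ h₁₀ hC hφ certificate = begin
      N ^ 5 * A * (4 * (k₁ * φ₁₁ - q₀ * ψ))
    ≡⟨ solve (N ∷ A ∷ k₁ ∷ q₀ ∷ φ₁₁ ∷ ψ ∷ []) ⟩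
      4 * A * (k₁ * (N ^ 2 * (N ^ 3 * φ₁₁)) - q₀ * N ^ 5 * ψ)
    ≡⟨ cong (λ u → 4 * A * (k₁ * u - q₀ * N ^ 5 * ψ)) φ₁₁-via-ψ ⟩
      4 * A * (k₁ * ((N + N) ^ 2 * (A - X) * (X + N) ^ 2 * ψ) - q₀ * N ^ 5 * ψ)
    ≡⟨ solve (X ∷ N ∷ A ∷ k₁ ∷ q₀ ∷ ψ ∷ []) ⟩
      4 * A * (k₁ * (N + N) ^ 2 * (A - X) * (X + N) ^ 2 - q₀ * N ^ 5) * ψ
    ≡⟨ cong (_* ψ) certificate ⟩
      N ^ 2 * A * p * (A - N) * (N + N) ^ 2 * (A - X) * (X + N) ^ 2 * ψ
    ≡⟨ solve (X ∷ N ∷ A ∷ p ∷ ψ ∷ []) ⟩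
      N ^ 2 * A * p * (A - N) * ((N + N) ^ 2 * (A - X) * (X + N) ^ 2 * ψ)
    ≡⟨ cong (N ^ 2 * A * p * (A - N) *_) φ₁₁-via-ψ ⟨
      N ^ 2 * A * p * (A - N) * (N ^ 2 * (N ^ 3 * φ₁₁))
    ≡⟨ solve (N ∷ A ∷ p ∷ φ₁₁ ∷ []) ⟩
      N ^ 7 * A * p * ((A - N) * φ₁₁)
    ≡⟨ cong (N ^ 7 * A * p *_) central-cubed ⟩
      N ^ 7 * A * p * (A * c ^ 3)
    ≡⟨ solve (N ∷ A ∷ p ∷ c ∷ []) ⟩
      N ^ 5 * A * (N ^ 2 * A * (p * c ^ 3))
    ∎
    where
      φ₁₁-via-ψ : N ^ 2 * (N ^ 3 * φ₁₁) ≡ (N + N) ^ 2 * (A - X) * (X + N) ^ 2 * ψ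
      φ₁₁-via-ψ = begin
        N ^ 2 * (N ^ 3 * φ₁₁)                       ≡⟨ cong (N ^ 2 *_) h₁₁ ⟩
        N ^ 2 * ((N + N) ^ 2 * (A - X) * φ₁₀)       ≡⟨ solve (X ∷ N ∷ A ∷ φ₁₀ ∷ []) ⟩
        (N + N) ^ 2 * (A - X) * (N ^ 2 * φ₁₀)       ≡⟨ cong ((N + N) ^ 2 * (A - X) *_) h₁₀ ⟩
        (N + N) ^ 2 * (A - X) * ((X + N) ^ 2 * ψ)   ≡⟨ solve (X ∷ N ∷ A ∷ ψ ∷ []) ⟩
        (N + N) ^ 2 * (A - X) * (X + N) ^ 2 * ψ     ∎
      central-cubed : (A - N) * φ₁₁ ≡ A * c ^ 3
      central-cubed = begin
        (A - N) * φ₁₁           ≡⟨ cong ((A - N) *_) hφ ⟩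
        (A - N) * (c ^ 2 * C′)  ≡⟨ solve (N ∷ A ∷ c ∷ C′ ∷ []) ⟩
        c ^ 2 * ((A - N) * C′)  ≡⟨ cong (c ^ 2 *_) hC ⟩
        c ^ 2 * (A * c)         ≡⟨ solve (A ∷ c ∷ []) ⟩
        A * c ^ 3               ∎

  central : ℕ → ℤ
  central m = + ((m ℕ.+ m) C m)

  wz-boundary : ∀ n → let N = + suc n in
    4 * (K₁ N * + φ (suc n) (suc n) - Γ n n) ≡ N ^ 2 * (1 + (N + N)) * (P N * central (suc n) ^ 3)
  wz-boundary n = *-cancelˡ-≡ (N ^ 5 * A) _ _
    (wz-boundary-cleared (+ n) N A (K₁ N) (q N N) (P N) (+ φ (suc n) (suc n)) (+ φ (suc n) n) (+ ψ n n)
      (central (suc n)) (+ (suc (suc n ℕ.+ suc n) C suc n))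
      (T-suc-k′ (suc n) n n≤2n+3)
      (T-suc-n′ n (suc (suc n ℕ.+ suc n)) n)
      ([n+1-k]*[n+1]Ck≡[n+1]*nCk (suc n ℕ.+ suc n) n+1≤2n+3)
      (pos-^-* ((suc n ℕ.+ suc n) C suc n) 2 (suc (suc n ℕ.+ suc n) C suc n))
      (proj₂ (proj₂ (certificates (+ n) 0))))
    where
      N = + suc n
      A = 1 + (N + N)
      n+1≤2n+3 : suc n ℕ.≤ suc (suc n ℕ.+ suc n)
      n+1≤2n+3 = ℕ.m≤n⇒m≤1+n (ℕ.m≤m+n (suc n) (suc n))
      n≤2n+3 : n ℕ.≤ suc (suc n ℕ.+ suc n)
      n≤2n+3 = ℕ.≤-trans (ℕ.n≤1+n n) n+1≤2n+3

  recurrence-cleared : ∀ (N A s V W φ₁ g r : ℤ) →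
    2 * N + 1 ≡ A →
    K₁ N * V - K₂ N * W ≡ s * g →
    4 * (K₁ N * φ₁ - g) ≡ N ^ 2 * A * r →
    N ^ 2 * A * (32 * A ^ 2 * (V + - s * φ₁) - 8 * N ^ 2 * W) ≡ N ^ 2 * A * (- s * r)
  recurrence-cleared N A s V W φ₁ g r 2N+1≡A telescoped diagonal = begin
      N ^ 2 * A * (32 * A ^ 2 * (V + - s * φ₁) - 8 * N ^ 2 * W)
    ≡⟨ solve (N ∷ A ∷ s ∷ V ∷ W ∷ φ₁ ∷ g ∷ []) ⟩
      4 * (8 * N ^ 2 * A ^ 3 * V - 2 * N ^ 4 * A * W) + - s * (4 * (8 * N ^ 2 * A ^ 3 * φ₁ - g)) - 4 * (s * g)
    ≡⟨ cong (λ a → 4 * (8 * N ^ 2 * a ^ 3 * V - 2 * N ^ 4 * a * W) + - s * (4 * (8 * N ^ 2 * a ^ 3 * φ₁ - g)) - 4 * (s * g))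
            2N+1≡A ⟨
      4 * (K₁ N * V - K₂ N * W) + - s * (4 * (K₁ N * φ₁ - g)) - 4 * (s * g)
    ≡⟨ cong₂ (λ u v → 4 * u + - s * v - 4 * (s * g)) telescoped diagonal ⟩
      4 * (s * g) + - s * (N ^ 2 * A * r) - 4 * (s * g)
    ≡⟨ solve (N ∷ A ∷ s ∷ g ∷ r ∷ []) ⟩
      N ^ 2 * A * (- s * r)
    ∎

  recurrence : ∀ n → let N = + suc n ; A = 1 + (N + N) in
    32 * A ^ 2 * U (suc n) (suc n) - 8 * N ^ 2 * U n n ≡ - sign n * (P N * central (suc n) ^ 3)
  recurrence n = *-cancelˡ-≡ (N ^ 2 * A) _ _
    (recurrence-cleared N A (sign n) (U (suc n) n) (U n n) (+ φ (suc n) (suc n)) (Γ n n)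
       (P N * central (suc n) ^ 3) (2x+1≡1+[x+x] N) (wz-telescoped n) (wz-boundary n))
    where
      N = + suc n
      A = 1 + (N + N)

  term-suc : ∀ n {k} → k ℕ.< n → term (suc n) k ≡ - term n k
  term-suc (suc n) {k} (ℕ.s≤s k≤n) = begin
    a * sign (suc n ℕ.∸ k) * b     ≡⟨ cong (λ t → a * sign t * b) (ℕ.+-∸-assoc 1 k≤n) ⟩
    a * - sign (n ℕ.∸ k) * b       ≡⟨ cong (_* b) (neg-distribʳ-* a (sign (n ℕ.∸ k))) ⟨
    - (a * sign (n ℕ.∸ k)) * b     ≡⟨ neg-distribˡ-* (a * sign (n ℕ.∸ k)) b ⟨
    - (a * sign (n ℕ.∸ k) * b)     ∎
    where
      a = + (205 ℕ.* k ℕ.* k ℕ.+ 160 ℕ.* k ℕ.+ 32)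
      b = + (((2 ℕ.* k) C k) ℕ.^ 5)

  sumTo-suc : ∀ n m → m ℕ.≤ n → sumTo (suc n) m ≡ - sumTo n m
  sumTo-suc n zero    _   = refl
  sumTo-suc n (suc m) m<n =
    trans (cong₂ _+_ (sumTo-suc n m (ℕ.<⇒≤ m<n)) (term-suc n m<n)) (sym (neg-distrib-+ (sumTo n m) (term n m)))

  S-suc : ∀ n → S (suc n) ≡ - S n + term (suc n) n
  S-suc n = cong (_+ term (suc n) n) (sumTo-suc n n ℕ.≤-refl)

  2*m≡m+m : ∀ m → 2 ℕ.* m ≡ m ℕ.+ m
  2*m≡m+m m = cong (m ℕ.+_) (ℕ.+-identityʳ m)

  P-cast : ∀ k → + (205 ℕ.* k ℕ.* k ℕ.+ 160 ℕ.* k ℕ.+ 32) ≡ P (+ k)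
  P-cast k = cong₂ (λ u v → u + v + 32)
    (trans (pos-* (205 ℕ.* k) k) (cong (_* + k) (pos-* 205 k))) (pos-* 160 k)

  term-diagonal : ∀ n → term (suc (suc n)) (suc n) ≡ P (+ suc n) * central (suc n) ^ 5
  term-diagonal n = begin
      + coefficient * sign (n ℕ.∸ n) * + (c ℕ.^ 5)
    ≡⟨ cong (λ t → + coefficient * sign t * + (c ℕ.^ 5)) (ℕ.n∸n≡0 n) ⟩
      + coefficient * 1 * + (c ℕ.^ 5)
    ≡⟨ cong₂ _*_ (trans (*-identityʳ (+ coefficient)) (P-cast (suc n))) (pos-^ c 5) ⟩
      P (+ suc n) * (+ c) ^ 5
    ≡⟨ cong (λ m → P (+ suc n) * (+ (m C suc n)) ^ 5) (2*m≡m+m (suc n)) ⟩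
      P (+ suc n) * central (suc n) ^ 5
    ∎
    where
      coefficient = 205 ℕ.* suc n ℕ.* suc n ℕ.+ 160 ℕ.* suc n ℕ.+ 32
      c = (2 ℕ.* suc n) C suc n

  denominator-cast : ∀ m → + (8 ℕ.* m ℕ.^ 2 ℕ.* ((2 ℕ.* m) C m) ℕ.^ 2) ≡ 8 * (+ m) ^ 2 * central m ^ 2
  denominator-cast m = begin
      + (8 ℕ.* m ℕ.^ 2 ℕ.* ((2 ℕ.* m) C m) ℕ.^ 2)
    ≡⟨ pos-* (8 ℕ.* m ℕ.^ 2) (((2 ℕ.* m) C m) ℕ.^ 2) ⟩
      + (8 ℕ.* m ℕ.^ 2) * + (((2 ℕ.* m) C m) ℕ.^ 2)
    ≡⟨ cong₂ _*_ (trans (pos-* 8 (m ℕ.^ 2)) (cong (8 *_) (pos-^ m 2))) (pos-^ ((2 ℕ.* m) C m) 2) ⟩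
      8 * (+ m) ^ 2 * (+ ((2 ℕ.* m) C m)) ^ 2
    ≡⟨ cong (λ k → 8 * (+ m) ^ 2 * (+ (k C m)) ^ 2) (2*m≡m+m m) ⟩
      8 * (+ m) ^ 2 * central m ^ 2
    ∎

  central-suc : ∀ m → + suc m * central (suc m) ≡ 2 * (1 + (+ m + + m)) * central m
  central-suc m = begin
    + suc m * central (suc m)                       ≡⟨ pos-* (suc m) _ ⟨
    + (suc m ℕ.* ((suc m ℕ.+ suc m) C suc m))       ≡⟨ cong +_ (central-binomial-suc m) ⟩
    + (2 ℕ.* suc (m ℕ.+ m) ℕ.* ((m ℕ.+ m) C m))     ≡⟨ pos-* (2 ℕ.* suc (m ℕ.+ m)) _ ⟩
    + (2 ℕ.* suc (m ℕ.+ m)) * central m             ≡⟨ cong (_* central m) (pos-* 2 (suc (m ℕ.+ m))) ⟩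
    2 * (1 + (+ m + + m)) * central m               ∎

  closed-form-step : ∀ (N A s c c′ V V′ p : ℤ) →
    (1 + N) * c′ ≡ 2 * A * c →
    32 * A ^ 2 * V′ - 8 * N ^ 2 * V ≡ - s * (p * c ^ 3) →
    s * s ≡ 1 →
    - (8 * N ^ 2 * c ^ 2 * (s * V)) + p * c ^ 5 ≡ 8 * (1 + N) ^ 2 * c′ ^ 2 * (- s * V′)
  closed-form-step N A s c c′ V V′ p central-step recurrence-step s²≡1 = begin
      - (8 * N ^ 2 * c ^ 2 * (s * V)) + p * c ^ 5
    ≡⟨ solve (N ∷ s ∷ c ∷ V ∷ p ∷ []) ⟩
      1 * (p * c ^ 5) - s * (8 * N ^ 2 * c ^ 2 * V)
    ≡⟨ cong (λ u → u * (p * c ^ 5) - s * (8 * N ^ 2 * c ^ 2 * V)) s²≡1 ⟨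
      s * s * (p * c ^ 5) - s * (8 * N ^ 2 * c ^ 2 * V)
    ≡⟨ solve (N ∷ s ∷ c ∷ V ∷ p ∷ []) ⟩
      - s * c ^ 2 * (- s * (p * c ^ 3)) - s * (8 * N ^ 2 * c ^ 2 * V)
    ≡⟨ cong (λ u → - s * c ^ 2 * u - s * (8 * N ^ 2 * c ^ 2 * V)) recurrence-step ⟨
      - s * c ^ 2 * (32 * A ^ 2 * V′ - 8 * N ^ 2 * V) - s * (8 * N ^ 2 * c ^ 2 * V)
    ≡⟨ solve (N ∷ A ∷ s ∷ c ∷ V ∷ V′ ∷ []) ⟩
      - s * 8 * (2 * A * c) ^ 2 * V′
    ≡⟨ cong (λ u → - s * 8 * u ^ 2 * V′) central-step ⟨
      - s * 8 * ((1 + N) * c′) ^ 2 * V′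
    ≡⟨ solve (N ∷ s ∷ c′ ∷ V′ ∷ []) ⟩
      8 * (1 + N) ^ 2 * c′ ^ 2 * (- s * V′)
    ∎

  S-closed-form : ∀ n → S (suc n) ≡ + (8 ℕ.* suc n ℕ.^ 2 ℕ.* ((2 ℕ.* suc n) C suc n) ℕ.^ 2) * (sign n * U n n)
  S-closed-form zero    = refl
  S-closed-form (suc n) = begin
      S (suc (suc n))
    ≡⟨ S-suc (suc n) ⟩
      - S (suc n) + term (suc (suc n)) (suc n)
    ≡⟨ cong₂ (λ u v → - u + v)
             (trans (S-closed-form n) (cong (_* (sign n * U n n)) (denominator-cast (suc n))))
             (term-diagonal n) ⟩
      - (8 * N ^ 2 * central (suc n) ^ 2 * (sign n * U n n)) + P N * central (suc n) ^ 5
    ≡⟨ closed-form-step N (1 + (N + N)) (sign n) (central (suc n)) (central (suc (suc n)))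
         (U n n) (U (suc n) (suc n)) (P N) (central-suc (suc n)) (recurrence n) (sign-square n) ⟩
      8 * (1 + N) ^ 2 * central (suc (suc n)) ^ 2 * (- sign n * U (suc n) (suc n))
    ≡⟨ cong (_* (sign (suc n) * U (suc n) (suc n))) (denominator-cast (suc (suc n))) ⟨
      + (8 ℕ.* suc (suc n) ℕ.^ 2 ℕ.* ((2 ℕ.* suc (suc n)) C suc (suc n)) ℕ.^ 2) * (sign (suc n) * U (suc n) (suc n))
    ∎
    where N = + suc n

  sign*U-positive : ∀ n → ∃ λ a → sign n * U n n ≡ + suc a
  sign*U-positive n with altSum-increasing (φ n) n (T>0 n {suc (n ℕ.+ n)} {0} ℕ.z≤n) φ-increasing
  ... | a , positive , _ = a , positive


open import Defs
open import Data.Nat using (ℕ; _*_; _^_; _>_; zero; suc; s≤s; z≤n)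
open import Data.Nat.Combinatorics using (_C_)
open import Data.Integer using (+_) renaming (_*_ to _*ℤ_)
open import Data.Product using (∃; _×_; _,_)
open import Relation.Binary.PropositionalEquality using (_≡_; trans; sym; cong)
open Sums using (S-closed-form; sign*U-positive)

corollary14 : (n : ℕ) → n > 0 →
    ∃ λ (a : ℕ) → a > 0 × (+ (8 * n ^ 2 * ((2 * n) C n) ^ 2) *ℤ + a ≡ S n)
corollary14 zero    ()
corollary14 (suc n) _ with sign*U-positive n
... | a , sU≡1+a = suc a , s≤s z≤n , trans (cong (denominator *ℤ_) (sym sU≡1+a)) (sym (S-closed-form n))
  where denominator = + (8 * suc n ^ 2 * ((2 * suc n) C suc n) ^ 2)
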